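{- For every graph $G=(V,E)$, nodes $s,t\in V$ and positive integers $0<r<\kappa$, $$\mathrm{OPT}_{\mathrm{UUMV}}(G,s,t,r,\kappa)=\mathrm{OPT}_{\mathrm{EHSSC}}\big(G,s,t,\lceil\kappa/r\rceil-1\big).$$
   Context: UUMV (Unweighted Uncapacitated Minimum Vulnerability): given $G=(V,E)$, $s,t\in V$ and integers $0<r<\kappa$, choose $\kappa$ paths between $s$ and $t$ minimizing the number of shared edges, an edge being shared if it lies in more than $r$ of the $\kappa$ paths; $\mathrm{OPT}_{\mathrm{UUMV}}(G,s,t,r,\kappa)$ is the optimal number of shared edges. An $s$-$t$ cut is a set $S\subseteq V$ with $s\in S$, $t\notin S$, with cut edges $\mathcal{E}_G(S,s,t)=\{\{u,v\}\in E:u\in S,v\in V\setminus S\}$. EHSSC (Edge hitting set for size-constrained cuts): given $G$, $s,t$ and a positive integer $k\le|E|$, find a minimum-cardinality $\widetilde E\subseteq E$ such that for every $S$ with $s\in S\subseteq V\setminus\{t\}$ and $|\mathcal{E}_G(S,s,t)|\le k$ we have $\mathcal{E}_G(S,s,t)\cap\widetilde E\neq\emptyset$; $\mathrm{OPT}_{\mathrm{EHSSC}}(G,s,t,k)$ is the size of such an optimal set. -}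

module Defs where

open import Data.Nat using (ℕ; suc; _+_; _∸_; _≤_; _<_; _<?_; NonZero; >-nonZero)
open import Data.Nat.DivMod using (_/_)
open import Data.Fin using (Fin; _≟_)
open import Data.Fin.Subset using (Subset; ∣_∣; _∈_; _∉_; _∩_; Nonempty)
open import Data.Bool using (Bool; _xor_)
open import Data.Vec using (lookup; tabulate)
open import Data.List using (List; []; _∷_)
import Data.List.Membership.DecPropositional as DecMem
open import Data.List.Relation.Unary.Unique.Propositional using (Unique)
open import Data.Product using (Σ; _×_; _,_; proj₁; proj₂)
open import Data.Sum using (_⊎_)
open import Relation.Binary.PropositionalEquality using (_≡_; _≢_)
open import Relation.Nullary using (does)

record Graph : Set where
  field
    n    : ℕ
    m    : ℕ
    ends : Fin m → Fin n × Fin n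
    loopless : ∀ e → proj₁ (ends e) ≢ proj₂ (ends e)
    simple   : ∀ e f →
               (ends e ≡ ends f ⊎ ends e ≡ (proj₂ (ends f) , proj₁ (ends f))) → e ≡ f

module _ (G : Graph) where
  open Graph G
  private module Mem = DecMem (_≟_ {n = m})

  V : Set
  V = Fin n

  E : Set
  E = Fin m

  Joins : E → V → V → Set
  Joins e x y = ends e ≡ (x , y) ⊎ ends e ≡ (y , x)

  data Walk : V → V → Set where
    nil  : ∀ {x} → Walk x x
    cons : ∀ {x y z} (e : E) → Joins e x y → Walk y z → Walk x z

  vertsOf : ∀ {x y} → Walk x y → List V
  vertsOf {x} nil = x ∷ []
  vertsOf {x} (cons _ _ w) = x ∷ vertsOf w

  edgesOf : ∀ {x y} → Walk x y → List E
  edgesOf nil = []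
  edgesOf (cons e _ w) = e ∷ edgesOf w

  Path : V → V → Set
  Path s t = Σ (Walk s t) (λ w → Unique (vertsOf w))

  usage : ∀ {s t κ} → (Fin κ → Path s t) → E → ℕ
  usage P e = ∣ tabulate (λ i → does (e Mem.∈? edgesOf (proj₁ (P i)))) ∣

  sharedEdges : ∀ {s t κ} → ℕ → (Fin κ → Path s t) → Subset m
  sharedEdges r P = tabulate (λ e → does (r <? usage P e))

  IsOptUUMV : V → V → ℕ → (κ : ℕ) → ℕ → Set
  IsOptUUMV s t r κ k =
    Σ (Fin κ → Path s t) (λ P → ∣ sharedEdges r P ∣ ≡ k) ×
    (∀ (P : Fin κ → Path s t) → k ≤ ∣ sharedEdges r P ∣)

  cutEdges : Subset n → Subset m
  cutEdges S = tabulate (λ e → lookup S (proj₁ (ends e)) xor lookup S (proj₂ (ends e)))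

  HitsSmallCuts : V → V → ℕ → Subset m → Set
  HitsSmallCuts s t k Ẽ =
    ∀ (S : Subset n) → s ∈ S → t ∉ S → ∣ cutEdges S ∣ ≤ k → Nonempty (cutEdges S ∩ Ẽ)

  IsOptEHSSC : V → V → ℕ → ℕ → Set
  IsOptEHSSC s t k c =
    Σ (Subset m) (λ Ẽ → HitsSmallCuts s t k Ẽ × ∣ Ẽ ∣ ≡ c) ×
    (∀ (Ẽ : Subset m) → HitsSmallCuts s t k Ẽ → c ≤ ∣ Ẽ ∣)

ceilDiv : ℕ → (b : ℕ) → 0 < b → ℕ
ceilDiv a b 0<b = _/_ (a + (b ∸ 1)) b ⦃ >-nonZero 0<b ⦄

-- The κ paths together cross every s–t cut at least κ times. A cut with at most ⌈κ/r⌉ − 1 edges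
-- and no shared edge would carry at most r(⌈κ/r⌉ − 1) < κ crossings, so the shared edges of any κ
-- paths hit every small cut. Conversely, if Ẽ hits every small cut, give the edges of Ẽ capacity κ
-- and all other edges capacity r: a small cut contains an edge of capacity κ and a large one has
-- capacity at least r⌈κ/r⌉ ≥ κ, so augmenting paths build an integral s–t flow of value κ within
-- these capacities. Peeling κ s–t paths off that flow uses every edge outside Ẽ at most r times,
-- so only edges of Ẽ are shared. Both constructions map solutions of one problem to solutions of
-- the other of no greater cost, hence the two optima coincide.

module Submission where

open import Defs
open import Data.Nat using (ℕ; _<_; _∸_)
open import Function.Bundles using (_⇔_; mk⇔)

import Data.Integer.Properties as ℤ
import Data.Nat.Properties as ℕ
import Data.List.Membership.DecPropositional as DecMembership
import Data.Vec.Base as Vec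
import Data.Vec.Functional as Vector

open import Algebra.Properties.Semiring.Sum ℤ.+-*-semiring
  using (sum; sum-syntax; sum-cong-≗; sum-replicate-zero; ∑-distrib-+; ∑-comm; *-distribˡ-sum; *-distribʳ-sum)
open import Data.Bool.Base using (Bool; true; false; T; _xor_; if_then_else_)
open import Data.Bool.Properties using (T?)
open import Data.Fin.Base using (Fin; zero; suc)
open import Data.Fin.Properties using (_≟_; any?)
open import Data.Fin.Subset using (Subset; ∣_∣; _∈_; _∉_; _∩_; _─_; ⁅_⁆; ∁; _⊆_)
open import Data.Fin.Subset.Properties
  using ( _∈?_; nonempty?; x∈⁅x⁆; x∈⁅y⁆⇒x≡y; x∈p⇒x∉∁p; x∉∁p⇒x∈p; ∣p∣≤n; x∈p⇒∣p-x∣<∣p∣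
        ; x∈p∧x≢y⇒x∈p-y; p─q⊆p; x∈p∩q⁺; x∈p∩q⁻; p⊆q⇒∣p∣≤∣q∣)
open import Data.Integer.Base as ℤ using (ℤ; +_; -_; _+_; _-_; _*_; 0ℤ; 1ℤ; -1ℤ; +≤+; +0; +[1+_]; -[1+_])
open import Data.Integer.Tactic.RingSolver using (solve-∀)
open import Data.List.Membership.Propositional using () renaming (_∈_ to _∈ₗ_; _∉_ to _∉ₗ_)
open import Data.List.Relation.Unary.All as All using (All; []; _∷_)
open import Data.List.Relation.Unary.AllPairs using ([]; _∷_)
open import Data.List.Relation.Unary.Any using (here; there)
open import Data.List.Relation.Unary.Unique.Propositional using (Unique)
open import Data.List.Relation.Unary.Unique.Propositional.Properties using (Unique[x∷xs]⇒x∉xs)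
open import Data.Nat as ℕ using (zero; suc; z<s)
open import Data.Nat.DivMod using (_/_; _%_; m/n*n≤m; m≥n⇒m/n>0; m≡m%n+[m/n]*n; m%n<n)
open import Data.Product using (Σ; ∃; _×_; _,_; proj₁; proj₂)
open import Data.Sum using (_⊎_; inj₁; inj₂)
open import Data.Unit using (⊤; tt)
open import Data.Vec.Base using (lookup; tabulate)
open import Data.Vec.Properties using (lookup∘tabulate; lookup⇒[]=; []=⇒lookup)
open import Function.Base using (_∘_)
open import Relation.Binary.PropositionalEquality
open import Relation.Nullary using (¬_; yes; no; does; contradiction)
open import Relation.Nullary.Decidable using (dec-true; dec-false; _×-dec_; isYes; toWitness; fromWitness)

-- Arithmetic and finite sums

ceilDiv-pred-bounds : ∀ κ r (0<r : 0 < r) → 0 < κ →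
                      r ℕ.* (ceilDiv κ r 0<r ∸ 1) < κ × κ ℕ.≤ r ℕ.* suc (ceilDiv κ r 0<r ∸ 1)
ceilDiv-pred-bounds κ (suc r') z<s 0<κ = below , above
  where
  open ℕ.≤-Reasoning
  q : ℕ
  q = (κ ℕ.+ r') / suc r'
  r*[1+[q∸1]]≡q*r : suc r' ℕ.* suc (q ∸ 1) ≡ q ℕ.* suc r'
  r*[1+[q∸1]]≡q*r =
    trans (cong (suc r' ℕ.*_) (ℕ.suc-pred q ⦃ ℕ.>-nonZero (m≥n⇒m/n>0 (ℕ.+-monoˡ-≤ r' 0<κ)) ⦄))
          (ℕ.*-comm (suc r') q)
  below : suc r' ℕ.* (q ∸ 1) < κ
  below = ℕ.+-cancelʳ-≤ r' _ κ (begin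
    suc (suc r' ℕ.* (q ∸ 1)) ℕ.+ r' ≡⟨ ℕ.+-suc _ r' ⟨
    suc r' ℕ.* (q ∸ 1) ℕ.+ suc r'   ≡⟨ trans (ℕ.+-comm _ (suc r')) (sym (ℕ.*-suc (suc r') (q ∸ 1))) ⟩
    suc r' ℕ.* suc (q ∸ 1)          ≡⟨ r*[1+[q∸1]]≡q*r ⟩
    q ℕ.* suc r'                    ≤⟨ m/n*n≤m (κ ℕ.+ r') (suc r') ⟩
    κ ℕ.+ r'                        ∎)
  above : κ ℕ.≤ suc r' ℕ.* suc (q ∸ 1)
  above = ℕ.+-cancelʳ-≤ r' κ _ (begin
    κ ℕ.+ r'                             ≡⟨ m≡m%n+[m/n]*n (κ ℕ.+ r') (suc r') ⟩
    (κ ℕ.+ r') % suc r' ℕ.+ q ℕ.* suc r' ≤⟨ ℕ.+-monoˡ-≤ _ (ℕ.s≤s⁻¹ (m%n<n (κ ℕ.+ r') (suc r'))) ⟩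
    r' ℕ.+ q ℕ.* suc r'                  ≡⟨ ℕ.+-comm r' _ ⟩
    q ℕ.* suc r' ℕ.+ r'                  ≡⟨ cong (ℕ._+ r') r*[1+[q∸1]]≡q*r ⟨
    suc r' ℕ.* suc (q ∸ 1) ℕ.+ r'        ∎)

𝟙 : Bool → ℤ
𝟙 true  = 1ℤ
𝟙 false = 0ℤ

δ : ∀ {k} → Fin k → Fin k → ℤ
δ i j = 𝟙 (does (i ≟ j))

δ-refl : ∀ {k} (i : Fin k) → δ i i ≡ 1ℤ
δ-refl i = cong 𝟙 (dec-true (i ≟ i) refl)

δ-≢ : ∀ {k} {i j : Fin k} → i ≢ j → δ i j ≡ 0ℤ
δ-≢ {i = i} {j} i≢j = cong 𝟙 (dec-false (i ≟ j) i≢j)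

∑-δ : ∀ {k} (f : Fin k → ℤ) j → ∑[ i < k ] (f i * δ i j) ≡ f j
∑-δ {suc k} f zero = begin
  f zero * 1ℤ + ∑[ i < k ] (f (suc i) * 0ℤ)
    ≡⟨ cong₂ _+_ (ℤ.*-identityʳ (f zero)) (sum-cong-≗ (λ i → ℤ.*-zeroʳ (f (suc i)))) ⟩
  f zero + ∑[ i < k ] 0ℤ
    ≡⟨ cong (λ x → f zero + x) (sum-replicate-zero k) ⟩
  f zero + 0ℤ
    ≡⟨ ℤ.+-identityʳ (f zero) ⟩
  f zero ∎
  where open ≡-Reasoning
∑-δ {suc k} f (suc j) = begin
  f zero * 0ℤ + ∑[ i < k ] (f (suc i) * δ i j) ≡⟨ cong₂ _+_ (ℤ.*-zeroʳ (f zero)) (∑-δ (f ∘ suc) j) ⟩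
  0ℤ + f (suc j)                                ≡⟨ ℤ.+-identityˡ (f (suc j)) ⟩
  f (suc j)                                     ∎
  where open ≡-Reasoning

∑-distrib-- : ∀ {k} (f g : Fin k → ℤ) → ∑[ i < k ] (f i - g i) ≡ sum f - sum g
∑-distrib-- {zero}  f g = refl
∑-distrib-- {suc k} f g =
  trans (cong (λ x → f zero - g zero + x) (∑-distrib-- (f ∘ suc) (g ∘ suc))) (interchange (f zero) (g zero) _ _)
  where
  interchange : ∀ a b c d → a - b + (c - d) ≡ a + c - (b + d)
  interchange = solve-∀

∑-δ-diff : ∀ {k} (φ : Fin k → ℤ) x y → ∑[ i < k ] (φ i * (δ i x - δ i y)) ≡ φ x - φ y
∑-δ-diff {k} φ x y = begin
  ∑[ i < k ] (φ i * (δ i x - δ i y))                  ≡⟨ sum-cong-≗ (λ i → distrib (φ i) (δ i x) (δ i y)) ⟩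
  ∑[ i < k ] (φ i * δ i x - φ i * δ i y)              ≡⟨ ∑-distrib-- (λ i → φ i * δ i x) (λ i → φ i * δ i y) ⟩
  ∑[ i < k ] (φ i * δ i x) - ∑[ i < k ] (φ i * δ i y) ≡⟨ cong₂ _-_ (∑-δ φ x) (∑-δ φ y) ⟩
  φ x - φ y                                           ∎
  where
  open ≡-Reasoning
  distrib : ∀ a b c → a * (b - c) ≡ a * b - a * c
  distrib = solve-∀

∑-mono-≤ : ∀ {k} {f g : Fin k → ℤ} → (∀ i → f i ℤ.≤ g i) → sum f ℤ.≤ sum g
∑-mono-≤ {zero}  f≤g = ℤ.≤-refl
∑-mono-≤ {suc k} f≤g = ℤ.+-mono-≤ (f≤g zero) (∑-mono-≤ (f≤g ∘ suc))

≤-∑ : ∀ {k} (f : Fin k → ℤ) → (∀ i → 0ℤ ℤ.≤ f i) → ∀ j → f j ℤ.≤ sum f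
≤-∑ f 0≤f j = begin
  f j                      ≡⟨ ∑-δ f j ⟨
  ∑[ i < _ ] (f i * δ i j) ≤⟨ ∑-mono-≤ (λ i → *𝟙≤ (0≤f i) (does (i ≟ j))) ⟩
  sum f                    ∎
  where
  open ℤ.≤-Reasoning
  *𝟙≤ : ∀ {x} → 0ℤ ℤ.≤ x → ∀ b → x * 𝟙 b ℤ.≤ x
  *𝟙≤ {x} _   true  = ℤ.≤-reflexive (ℤ.*-identityʳ x)
  *𝟙≤ {x} 0≤x false = ℤ.≤-trans (ℤ.≤-reflexive (ℤ.*-zeroʳ x)) 0≤x

∑-1 : ∀ k → ∑[ i < k ] 1ℤ ≡ + k
∑-1 zero    = refl
∑-1 (suc k) = cong (λ x → 1ℤ + x) (∑-1 k)

∣tabulate∣≡∑𝟙 : ∀ {k} (p : Fin k → Bool) → + ∣ tabulate p ∣ ≡ ∑[ i < k ] 𝟙 (p i)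
∣tabulate∣≡∑𝟙 {zero}  p = refl
∣tabulate∣≡∑𝟙 {suc k} p with p zero
... | true  = cong (λ x → 1ℤ + x) (∣tabulate∣≡∑𝟙 (p ∘ suc))
... | false = trans (∣tabulate∣≡∑𝟙 (p ∘ suc)) (sym (ℤ.+-identityˡ _))

0≤𝟙*𝟙 : ∀ a b → 0ℤ ℤ.≤ 𝟙 a * 𝟙 b
0≤𝟙*𝟙 true  true  = +≤+ ℕ.z≤n
0≤𝟙*𝟙 true  false = ℤ.≤-refl
0≤𝟙*𝟙 false _     = ℤ.≤-refl

0≤𝟙*+ : ∀ b k → 0ℤ ℤ.≤ 𝟙 b * + k
0≤𝟙*+ true  k = ℤ.≤-trans (+≤+ ℕ.z≤n) (ℤ.≤-reflexive (sym (ℤ.*-identityˡ (+ k))))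
0≤𝟙*+ false k = ℤ.≤-refl

𝟙*-monoʳ-≤ : ∀ b {x y} → (b ≡ true → x ℤ.≤ y) → 𝟙 b * x ℤ.≤ 𝟙 b * y
𝟙*-monoʳ-≤ true  {x} {y} x≤y = subst₂ ℤ._≤_ (sym (ℤ.*-identityˡ x)) (sym (ℤ.*-identityˡ y)) (x≤y refl)
𝟙*-monoʳ-≤ false         _   = ℤ.≤-refl

IsUnit : ℤ → Set
IsUnit o = o ≡ 1ℤ ⊎ o ≡ -1ℤ

push-unit-feasible : ∀ {c x o} → IsUnit o → o * x ℤ.< c → - c ℤ.≤ x → x ℤ.≤ c →
                     - c ℤ.≤ x + 1ℤ * o × x + 1ℤ * o ℤ.≤ c
push-unit-feasible {c} {x} (inj₁ refl) x<c -c≤x _ = ℤ.≤-trans -c≤x (ℤ.i≤i+j x 1ℤ) , x+1≤c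
  where
  x+1≤c : x + 1ℤ ℤ.≤ c
  x+1≤c = subst (ℤ._≤ c) (ℤ.+-comm 1ℤ x) (ℤ.i<j⇒suc[i]≤j (subst (ℤ._< c) (ℤ.*-identityˡ x) x<c))
push-unit-feasible {c} {x} (inj₂ refl) -x<c _ x≤c = -c≤x-1 , ℤ.i≤j⇒i-k≤j 1ℤ x≤c
  where
  -c<x : - c ℤ.< x
  -c<x = subst (- c ℤ.<_) (ℤ.neg-involutive x) (ℤ.neg-mono-< (subst (ℤ._< c) (ℤ.-1*i≡-i x) -x<c))
  -c≤x-1 : - c ℤ.≤ x + -1ℤ
  -c≤x-1 = subst (- c ℤ.≤_) (ℤ.+-comm -1ℤ x) (ℤ.i<j⇒i≤pred[j] -c<x)

pull-unit-∣∣ : ∀ {x o} → IsUnit o → 0ℤ ℤ.< o * x → suc ℤ.∣ x + -1ℤ * o ∣ ≡ ℤ.∣ x ∣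
pull-unit-∣∣ {+[1+ _ ]}      (inj₁ refl) _ = refl
pull-unit-∣∣ {+0}            (inj₁ refl) (ℤ.+<+ ())
pull-unit-∣∣ { -[1+ _ ]}     (inj₁ refl) ()
pull-unit-∣∣ { -[1+ zero ]}  (inj₂ refl) _ = refl
pull-unit-∣∣ { -[1+ suc _ ]} (inj₂ refl) _ = refl
pull-unit-∣∣ {+0}            (inj₂ refl) (ℤ.+<+ ())
pull-unit-∣∣ {+[1+ _ ]}      (inj₂ refl) ()

-n≤i≤n⇒∣i∣≤n : ∀ {x c} → - (+ c) ℤ.≤ x → x ℤ.≤ + c → ℤ.∣ x ∣ ℕ.≤ c
-n≤i≤n⇒∣i∣≤n {+ _}                  _             (+≤+ k≤c) = k≤c
-n≤i≤n⇒∣i∣≤n { -[1+ _ ]} {zero}  ()            _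
-n≤i≤n⇒∣i∣≤n { -[1+ _ ]} {suc _} (ℤ.-≤- k≤c) _         = ℕ.s≤s k≤c

lookup-∉ : ∀ {k} {S : Subset k} {x} → x ∉ S → lookup S x ≡ false
lookup-∉ {S = S} {x} x∉S with lookup S x in eq
... | true  = contradiction (lookup⇒[]= x S eq) x∉S
... | false = refl

∈-tabulate⁺ : ∀ {k} {p : Fin k → Bool} {i} → p i ≡ true → i ∈ tabulate p
∈-tabulate⁺ {p = p} {i} pi≡true = lookup⇒[]= i (tabulate p) (trans (lookup∘tabulate p i) pi≡true)

∈-tabulate⁻ : ∀ {k} {p : Fin k → Bool} {i} → i ∈ tabulate p → p i ≡ true
∈-tabulate⁻ {p = p} {i} i∈p = trans (sym (lookup∘tabulate p i)) ([]=⇒lookup i∈p)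

x∉p─⁅x⁆ : ∀ {k} (p : Subset k) x → x ∉ p ─ ⁅ x ⁆
x∉p─⁅x⁆ (_ Vec.∷ p) zero    ()
x∉p─⁅x⁆ (_ Vec.∷ p) (suc x) (Vec.there x∈) = x∉p─⁅x⁆ p x x∈

module _ (G : Graph) where
  open Graph G
  open DecMembership (_≟_ {n = m}) using () renaming (_∈?_ to _∈ₗ?_)

  -- Flows

  src tgt : E G → V G
  src e = proj₁ (ends e)
  tgt e = proj₂ (ends e)

  ⟦_⟧ : Subset n → V G → ℤ
  ⟦ S ⟧ v = 𝟙 (lookup S v)

  crosses : Subset n → E G → Bool
  crosses S e = lookup S (src e) xor lookup S (tgt e)

  -- f e is the amount sent along e from src e to tgt e; a negative amount goes the other way.
  Flow : Set
  Flow = E G → ℤ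

  ∂ : (V G → ℤ) → E G → ℤ
  ∂ φ e = φ (src e) - φ (tgt e)

  excess : Flow → V G → ℤ
  excess f v = ∑[ e < m ] (∂ (δ v) e * f e)

  outflow : Flow → Subset n → ℤ
  outflow f S = ∑[ e < m ] (∂ ⟦ S ⟧ e * f e)

  summation-by-parts : ∀ φ f → ∑[ e < m ] (∂ φ e * f e) ≡ ∑[ v < n ] (φ v * excess f v)
  summation-by-parts φ f = begin
    ∑[ e < m ] (∂ φ e * f e)
      ≡⟨ sum-cong-≗ (λ e → cong (_* f e) (∑-δ-diff φ (src e) (tgt e))) ⟨
    ∑[ e < m ] (∑[ v < n ] (φ v * ∂ (δ v) e) * f e)
      ≡⟨ sum-cong-≗ (λ e → *-distribʳ-sum (f e) (λ v → φ v * ∂ (δ v) e)) ⟩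
    ∑[ e < m ] ∑[ v < n ] (φ v * ∂ (δ v) e * f e)
      ≡⟨ sum-cong-≗ (λ e → sum-cong-≗ (λ v → ℤ.*-assoc (φ v) _ (f e))) ⟩
    ∑[ e < m ] ∑[ v < n ] (φ v * (∂ (δ v) e * f e))
      ≡⟨ ∑-comm (λ e v → φ v * (∂ (δ v) e * f e)) ⟩
    ∑[ v < n ] ∑[ e < m ] (φ v * (∂ (δ v) e * f e))
      ≡⟨ sum-cong-≗ (λ v → *-distribˡ-sum (φ v) (λ e → ∂ (δ v) e * f e)) ⟨
    ∑[ v < n ] (φ v * excess f v) ∎
    where open ≡-Reasoning

  IsFlow : V G → V G → ℤ → Flow → Set
  IsFlow s t J f = ∀ v → excess f v ≡ (δ v s - δ v t) * J

  flow-value : ∀ {s t J f} → IsFlow s t J f → ∀ φ → ∑[ e < m ] (∂ φ e * f e) ≡ (φ s - φ t) * J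
  flow-value {s} {t} {J} {f} flow φ = begin
    ∑[ e < m ] (∂ φ e * f e)
      ≡⟨ summation-by-parts φ f ⟩
    ∑[ v < n ] (φ v * excess f v)
      ≡⟨ sum-cong-≗ (λ v → trans (cong (φ v *_) (flow v)) (sym (ℤ.*-assoc (φ v) _ J))) ⟩
    ∑[ v < n ] (φ v * (δ v s - δ v t) * J)
      ≡⟨ *-distribʳ-sum J (λ v → φ v * (δ v s - δ v t)) ⟨
    ∑[ v < n ] (φ v * (δ v s - δ v t)) * J
      ≡⟨ cong (_* J) (∑-δ-diff φ s t) ⟩
    (φ s - φ t) * J ∎
    where open ≡-Reasoning

  flow-out-of-cut : ∀ {s t J f S} → IsFlow s t J f → s ∈ S → t ∉ S → outflow f S ≡ J
  flow-out-of-cut {s} {t} {J} {f} {S} flow s∈S t∉S = begin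
    outflow f S             ≡⟨ flow-value flow ⟦ S ⟧ ⟩
    (⟦ S ⟧ s - ⟦ S ⟧ t) * J ≡⟨ cong₂ (λ a b → (𝟙 a - 𝟙 b) * J) ([]=⇒lookup s∈S) (lookup-∉ t∉S) ⟩
    1ℤ * J                  ≡⟨ ℤ.*-identityˡ J ⟩
    J                       ∎
    where open ≡-Reasoning

  excess-linear : ∀ f g c v → excess (λ e → f e + c * g e) v ≡ excess f v + c * excess g v
  excess-linear f g c v = begin
    ∑[ e < m ] (∂ (δ v) e * (f e + c * g e))
      ≡⟨ sum-cong-≗ (λ e → expand (∂ (δ v) e) (f e) c (g e)) ⟩
    ∑[ e < m ] (∂ (δ v) e * f e + c * (∂ (δ v) e * g e))
      ≡⟨ ∑-distrib-+ (λ e → ∂ (δ v) e * f e) _ ⟩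
    excess f v + ∑[ e < m ] (c * (∂ (δ v) e * g e))
      ≡⟨ cong (λ x → excess f v + x) (*-distribˡ-sum c (λ e → ∂ (δ v) e * g e)) ⟨
    excess f v + c * excess g v ∎
    where
    open ≡-Reasoning
    expand : ∀ a x c y → a * (x + c * y) ≡ a * x + c * (a * y)
    expand = solve-∀

  excess-zero : ∀ v → excess (λ _ → 0ℤ) v ≡ 0ℤ
  excess-zero v = trans (sum-cong-≗ (λ e → ℤ.*-zeroʳ (∂ (δ v) e))) (sum-replicate-zero m)

  orientation : ∀ {e x y} → Joins G e x y → ℤ
  orientation (inj₁ _) = 1ℤ
  orientation (inj₂ _) = -1ℤ

  orientation-IsUnit : ∀ {e x y} (j : Joins G e x y) → IsUnit (orientation j)
  orientation-IsUnit (inj₁ _) = inj₁ refl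
  orientation-IsUnit (inj₂ _) = inj₂ refl

  orientation*∂ : ∀ {e x y} (j : Joins G e x y) φ → orientation j * ∂ φ e ≡ φ x - φ y
  orientation*∂ (inj₁ e≡xy) φ =
    trans (ℤ.*-identityˡ _) (cong (λ p → φ (proj₁ p) - φ (proj₂ p)) e≡xy)
  orientation*∂ {x = x} {y} (inj₂ e≡yx) φ =
    trans (cong (λ p → -1ℤ * (φ (proj₁ p) - φ (proj₂ p))) e≡yx) (reverse (φ y) (φ x))
    where
    reverse : ∀ a b → - 1ℤ * (a - b) ≡ b - a
    reverse = solve-∀

  pathFlow : ∀ {x z} → Walk G x z → Flow
  pathFlow nil          e' = 0ℤ
  pathFlow (cons e j w) e' = pathFlow w e' + orientation j * δ e' e

  excess-pathFlow : ∀ {x z} (w : Walk G x z) v → excess (pathFlow w) v ≡ δ v x - δ v z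
  excess-pathFlow {x} nil v = trans (excess-zero v) (sym (ℤ.+-inverseʳ (δ v x)))
  excess-pathFlow {x} {z} (cons {y = y} e j w) v = begin
    excess (pathFlow (cons e j w)) v
      ≡⟨ excess-linear (pathFlow w) (λ e' → δ e' e) (orientation j) v ⟩
    excess (pathFlow w) v + orientation j * ∑[ e' < m ] (∂ (δ v) e' * δ e' e)
      ≡⟨ cong₂ (λ a b → a + orientation j * b) (excess-pathFlow w v) (∑-δ (∂ (δ v)) e) ⟩
    (δ v y - δ v z) + orientation j * ∂ (δ v) e
      ≡⟨ cong (λ b → (δ v y - δ v z) + b) (orientation*∂ j (δ v)) ⟩
    (δ v y - δ v z) + (δ v x - δ v y)
      ≡⟨ telescope (δ v x) (δ v y) (δ v z) ⟩
    δ v x - δ v z ∎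
    where
    open ≡-Reasoning
    telescope : ∀ a b c → (b - c) + (a - b) ≡ a - c
    telescope = solve-∀

  push : ∀ {x z} → Flow → Walk G x z → ℤ → Flow
  push f w d e = f e + d * pathFlow w e

  push-IsFlow : ∀ {s t J f} → IsFlow s t J f → (w : Walk G s t) → ∀ d → IsFlow s t (d + J) (push f w d)
  push-IsFlow {s} {t} {J} {f} flow w d v = begin
    excess (push f w d) v                     ≡⟨ excess-linear f (pathFlow w) d v ⟩
    excess f v + d * excess (pathFlow w) v    ≡⟨ cong₂ (λ a b → a + d * b) (flow v) (excess-pathFlow w v) ⟩
    (δ v s - δ v t) * J + d * (δ v s - δ v t) ≡⟨ factor (δ v s - δ v t) J d ⟩
    (δ v s - δ v t) * (d + J)                 ∎
    where
    open ≡-Reasoning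
    factor : ∀ a J d → a * J + d * a ≡ a * (d + J)
    factor = solve-∀

  pathFlow-cons-≢ : ∀ {x y z e e'} (j : Joins G e x y) (w : Walk G y z) → e' ≢ e →
                    pathFlow (cons e j w) e' ≡ pathFlow w e'
  pathFlow-cons-≢ {e = e} {e'} j w e'≢e = begin
    pathFlow w e' + orientation j * δ e' e ≡⟨ cong (λ d → pathFlow w e' + orientation j * d) (δ-≢ e'≢e) ⟩
    pathFlow w e' + orientation j * 0ℤ     ≡⟨ cong (λ d → pathFlow w e' + d) (ℤ.*-zeroʳ (orientation j)) ⟩
    pathFlow w e' + 0ℤ                     ≡⟨ ℤ.+-identityʳ _ ⟩
    pathFlow w e'                          ∎
    where open ≡-Reasoning

  pathFlow-∉ : ∀ {x z e} (w : Walk G x z) → e ∉ₗ edgesOf G w → pathFlow w e ≡ 0ℤ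
  pathFlow-∉ nil          _   = refl
  pathFlow-∉ (cons e j w) e∉w = trans (pathFlow-cons-≢ j w (e∉w ∘ here)) (pathFlow-∉ w (e∉w ∘ there))

  start-∈ : ∀ {x z} (w : Walk G x z) → x ∈ₗ vertsOf G w
  start-∈ nil          = here refl
  start-∈ (cons _ _ _) = here refl

  endpoints-∈ : ∀ {x z e u} (w : Walk G x z) → e ∈ₗ edgesOf G w → src e ≡ u ⊎ tgt e ≡ u → u ∈ₗ vertsOf G w
  endpoints-∈ (cons e (inj₁ e≡xy) w) (here refl) (inj₁ refl) = here (cong proj₁ e≡xy)
  endpoints-∈ (cons e (inj₁ e≡xy) w) (here refl) (inj₂ refl) =
    there (subst (_∈ₗ vertsOf G w) (sym (cong proj₂ e≡xy)) (start-∈ w))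
  endpoints-∈ (cons e (inj₂ e≡yx) w) (here refl) (inj₁ refl) =
    there (subst (_∈ₗ vertsOf G w) (sym (cong proj₁ e≡yx)) (start-∈ w))
  endpoints-∈ (cons e (inj₂ e≡yx) w) (here refl) (inj₂ refl) = here (cong proj₂ e≡yx)
  endpoints-∈ (cons _ _ w)           (there e∈w) u-end       = there (endpoints-∈ w e∈w u-end)

  first-edge-fresh : ∀ {x y z e} (j : Joins G e x y) (w : Walk G y z) →
                     Unique (vertsOf G (cons e j w)) → e ∉ₗ edgesOf G w
  first-edge-fresh (inj₁ e≡xy) w uniq e∈w = Unique[x∷xs]⇒x∉xs uniq (endpoints-∈ w e∈w (inj₁ (cong proj₁ e≡xy)))
  first-edge-fresh (inj₂ e≡yx) w uniq e∈w = Unique[x∷xs]⇒x∉xs uniq (endpoints-∈ w e∈w (inj₂ (cong proj₂ e≡yx)))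

  -- R e o holds when one more unit may be sent along e in direction o (1 or -1).
  Residual : Set
  Residual = E G → ℤ → Bool

  AllowedWalk : ∀ {x z} → Residual → Walk G x z → Set
  AllowedWalk R nil          = ⊤
  AllowedWalk R (cons e j w) = T (R e (orientation j)) × AllowedWalk R w

  pathFlow-∈ : ∀ {x z e} R (w : Walk G x z) → Unique (vertsOf G w) → AllowedWalk R w → e ∈ₗ edgesOf G w →
               IsUnit (pathFlow w e) × T (R e (pathFlow w e))
  pathFlow-∈ R (cons e j w) uniq (allowed , _) (here refl) =
    subst (λ o → IsUnit o × T (R e o)) (sym on-e) (orientation-IsUnit j , allowed)
    where
    on-e : pathFlow (cons e j w) e ≡ orientation j
    on-e = begin
      pathFlow w e + orientation j * δ e e
        ≡⟨ cong₂ (λ a d → a + orientation j * d) (pathFlow-∉ w (first-edge-fresh j w uniq)) (δ-refl e) ⟩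
      0ℤ + orientation j * 1ℤ
        ≡⟨ ℤ.+-identityˡ _ ⟩
      orientation j * 1ℤ
        ≡⟨ ℤ.*-identityʳ _ ⟩
      orientation j ∎
      where open ≡-Reasoning
  pathFlow-∈ {e = e'} R (cons e j w) uniq@(_ ∷ uniq-w) (_ , allowed-w) (there e'∈w) =
    subst (λ o → IsUnit o × T (R e' o)) (sym (pathFlow-cons-≢ j w e'≢e)) (pathFlow-∈ R w uniq-w allowed-w e'∈w)
    where
    e'≢e : e' ≢ e
    e'≢e refl = first-edge-fresh j w uniq e'∈w

  -- Augmenting-path search

  exit-arc : ∀ U e → T (crosses U e) →
             Σ (V G) λ x → Σ (V G) λ y → Σ (Joins G e x y) λ j → x ∈ U × y ∉ U × orientation j ≡ ∂ ⟦ U ⟧ e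
  exit-arc U e crossing with lookup U (src e) in src-in | lookup U (tgt e) in tgt-in
  ... | true  | false = src e , tgt e , inj₁ refl , lookup⇒[]= (src e) U src-in
                      , (λ tgt∈U → contradiction (trans (sym ([]=⇒lookup tgt∈U)) tgt-in) λ ())
                      , refl
  ... | false | true  = tgt e , src e , inj₂ refl , lookup⇒[]= (tgt e) U tgt-in
                      , (λ src∈U → contradiction (trans (sym ([]=⇒lookup src∈U)) src-in) λ ())
                      , refl

  module _ (R : Residual) where

    -- On an edge crossing S, ∂ ⟦ S ⟧ e is the direction in which the edge leaves S.
    Closed : Subset n → Set
    Closed S = ∀ e → T (crosses S e) → ¬ T (R e (∂ ⟦ S ⟧ e))

    data PathOrCut (s t : V G) : Set where
      path : (p : Path G s t) → AllowedWalk R (proj₁ p) → PathOrCut s t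
      cut  : (S : Subset n) → s ∈ S → t ∉ S → Closed S → PathOrCut s t

    -- The search runs backwards from t; U is the set of vertices not yet known to reach t.
    Explored : V G → Subset n → Set
    Explored t U = ∀ v → v ∉ U → Σ (Path G v t) λ p → AllowedWalk R (proj₁ p) × All (_∉ U) (vertsOf G (proj₁ p))

    explore-arc : ∀ {t U x y e} (j : Joins G e x y) → T (R e (orientation j)) → x ∈ U → y ∉ U →
                  Explored t U → Explored t (U ─ ⁅ x ⁆)
    explore-arc {U = U} {x} j allowed x∈U y∉U explored v v∉U─x with v ≟ x
    ... | yes refl =
      let (w , uniq) , allowed-w , avoids = explored _ y∉U in
      (cons _ j w , All.map (λ u∉U x≡u → u∉U (subst (_∈ U) x≡u x∈U)) avoids ∷ uniq) ,
      (allowed , allowed-w) , (x∉p─⁅x⁆ U x ∷ All.map still-outside avoids)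
      where
      still-outside : ∀ {u} → u ∉ U → u ∉ U ─ ⁅ x ⁆
      still-outside u∉U = u∉U ∘ p─q⊆p U ⁅ x ⁆
    ... | no v≢x =
      let p , allowed-p , avoids = explored v (v∉U─x ∘ λ v∈U → x∈p∧x≢y⇒x∈p-y v∈U v≢x) in
      p , allowed-p , All.map (λ u∉U → u∉U ∘ p─q⊆p U ⁅ x ⁆) avoids

    conclude : ∀ {s t} U → t ∉ U → Explored t U → Closed U → PathOrCut s t
    conclude {s} U t∉U explored closed with s ∈? U
    ... | yes s∈U = cut U s∈U t∉U closed
    ... | no  s∉U = let p , allowed , _ = explored s s∉U in path p allowed

    explore : ∀ {s t} k U → ∣ U ∣ ℕ.≤ k → t ∉ U → Explored t U → PathOrCut s t
    explore {s} zero U ∣U∣≤0 t∉U explored =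
      let p , allowed , _ = explored s (λ s∈U → ℕ.n≮0 (ℕ.<-≤-trans (x∈p⇒∣p-x∣<∣p∣ s∈U) ∣U∣≤0)) in
      path p allowed
    explore (suc k) U ∣U∣≤1+k t∉U explored with any? (λ e → T? (crosses U e) ×-dec T? (R e (∂ ⟦ U ⟧ e)))
    ... | no stuck = conclude U t∉U explored (λ e crossing allowed → stuck (e , crossing , allowed))
    ... | yes (e , crossing , allowed) with exit-arc U e crossing
    ...   | x , y , j , x∈U , y∉U , o≡∂ =
      explore k (U ─ ⁅ x ⁆) (ℕ.s≤s⁻¹ (ℕ.<-≤-trans (x∈p⇒∣p-x∣<∣p∣ x∈U) ∣U∣≤1+k))
              (t∉U ∘ p─q⊆p U ⁅ x ⁆) (explore-arc j (subst (T ∘ R e) (sym o≡∂) allowed) x∈U y∉U explored)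

    search : ∀ s t → PathOrCut s t
    search s t = explore n (∁ ⁅ t ⁆) (∣p∣≤n (∁ ⁅ t ⁆)) t∉∁⁅t⁆ explored₀
      where
      t∉∁⁅t⁆ : t ∉ ∁ ⁅ t ⁆
      t∉∁⁅t⁆ = x∈p⇒x∉∁p (x∈⁅x⁆ t)
      explored₀ : Explored t (∁ ⁅ t ⁆)
      explored₀ v v∉∁⁅t⁆ with x∈⁅y⁆⇒x≡y t (x∉∁p⇒x∈p v∉∁⁅t⁆)
      ... | refl = (nil , [] ∷ []) , tt , t∉∁⁅t⁆ ∷ []

  -- Maximum flow and flow decomposition

  ∂-uncrossed : ∀ S e → crosses S e ≡ false → ∂ ⟦ S ⟧ e ≡ 0ℤ
  ∂-uncrossed S e with lookup S (src e) | lookup S (tgt e)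
  ... | true  | true  = λ _ → refl
  ... | true  | false = λ ()
  ... | false | true  = λ ()
  ... | false | false = λ _ → refl

  capacity : (E G → ℕ) → Subset n → ℤ
  capacity cap S = ∑[ e < m ] (𝟙 (crosses S e) * + cap e)

  Feasible : (E G → ℕ) → Flow → Set
  Feasible cap f = ∀ e → - (+ cap e) ℤ.≤ f e × f e ℤ.≤ + cap e

  residual : (E G → ℕ) → Flow → Residual
  residual cap f e o = isYes (o * f e ℤ.<? + cap e)

  closed-cut-saturated : ∀ {cap f S} → Closed (residual cap f) S → capacity cap S ℤ.≤ outflow f S
  closed-cut-saturated {cap} {f} {S} closed = ∑-mono-≤ saturated
    where
    saturated : ∀ e → 𝟙 (crosses S e) * + cap e ℤ.≤ ∂ ⟦ S ⟧ e * f e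
    saturated e with crosses S e in crossing
    ... | false = ℤ.≤-reflexive (sym (trans (cong (_* f e) (∂-uncrossed S e crossing)) (ℤ.*-zeroˡ (f e))))
    ... | true  = ℤ.≤-trans (ℤ.≤-reflexive (ℤ.*-identityˡ _)) (ℤ.≮⇒≥ λ room →
                    closed e (subst T (sym crossing) tt) (fromWitness {a? = ∂ ⟦ S ⟧ e * f e ℤ.<? + cap e} room))

  augment : ∀ {cap s t κ j f} → (∀ S → s ∈ S → t ∉ S → + κ ℤ.≤ capacity cap S) → j < κ →
            Feasible cap f → IsFlow s t (+ j) f → Σ Flow λ f' → Feasible cap f' × IsFlow s t (+ suc j) f'
  augment {cap} {s} {t} {κ} {j} {f} min-cut j<κ feasible flow with search (residual cap f) s t
  ... | path (w , uniq) allowed = push f w 1ℤ , feasible-push , push-IsFlow flow w 1ℤ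
    where
    feasible-push : Feasible cap (push f w 1ℤ)
    feasible-push e with e ∈ₗ? edgesOf G w
    ... | yes e∈w =
      let unit , room = pathFlow-∈ (residual cap f) w uniq allowed e∈w in
      push-unit-feasible unit (toWitness {a? = pathFlow w e * f e ℤ.<? + cap e} room)
                         (proj₁ (feasible e)) (proj₂ (feasible e))
    ... | no e∉w =
      subst (λ x → - (+ cap e) ℤ.≤ x × x ℤ.≤ + cap e)
            (sym (trans (cong (λ o → f e + 1ℤ * o) (pathFlow-∉ w e∉w)) (ℤ.+-identityʳ (f e)))) (feasible e)
  ... | cut S s∈S t∉S closed = contradiction (ℤ.+<+ j<κ) (ℤ.≤⇒≯ (begin
    + κ            ≤⟨ min-cut S s∈S t∉S ⟩
    capacity cap S ≤⟨ closed-cut-saturated {cap} {f} {S} closed ⟩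
    outflow f S    ≡⟨ flow-out-of-cut flow s∈S t∉S ⟩
    + j            ∎))
    where open ℤ.≤-Reasoning

  integral-flow : ∀ {cap s t κ} → (∀ S → s ∈ S → t ∉ S → + κ ℤ.≤ capacity cap S) →
                  ∀ j → j ℕ.≤ κ → Σ Flow λ f → Feasible cap f × IsFlow s t (+ j) f
  integral-flow {s = s} {t} min-cut zero _ =
    (λ _ → 0ℤ) , (λ _ → ℤ.neg-≤-pos , +≤+ ℕ.z≤n) ,
    (λ v → trans (excess-zero v) (sym (ℤ.*-zeroʳ (δ v s - δ v t))))
  integral-flow min-cut (suc j) j<κ =
    let f , feasible , flow = integral-flow min-cut j (ℕ.<⇒≤ j<κ) in augment min-cut j<κ feasible flow

  forward : Flow → Residual
  forward f e o = isYes (0ℤ ℤ.<? o * f e)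

  closed-cut-outflow≤0 : ∀ {f S} → Closed (forward f) S → outflow f S ℤ.≤ 0ℤ
  closed-cut-outflow≤0 {f} {S} closed = ℤ.≤-trans (∑-mono-≤ nonpositive) (ℤ.≤-reflexive (sum-replicate-zero m))
    where
    nonpositive : ∀ e → ∂ ⟦ S ⟧ e * f e ℤ.≤ 0ℤ
    nonpositive e with crosses S e in crossing
    ... | false = ℤ.≤-reflexive (trans (cong (_* f e) (∂-uncrossed S e crossing)) (ℤ.*-zeroˡ (f e)))
    ... | true  = ℤ.≮⇒≥ λ positive →
                    closed e (subst T (sym crossing) tt) (fromWitness {a? = 0ℤ ℤ.<? ∂ ⟦ S ⟧ e * f e} positive)

  decompose : ∀ {s t} j f → IsFlow s t (+ j) f → Σ (Fin j → Path G s t) λ P → ∀ e → usage G P e ℕ.≤ ℤ.∣ f e ∣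
  decompose zero f _ = (λ ()) , λ _ → ℕ.z≤n
  decompose {s} {t} (suc j) f flow with search (forward f) s t
  ... | cut S s∈S t∉S closed = contradiction (ℤ.+<+ z<s) (ℤ.≤⇒≯ (begin
    + suc j     ≡⟨ flow-out-of-cut flow s∈S t∉S ⟨
    outflow f S ≤⟨ closed-cut-outflow≤0 {f} {S} closed ⟩
    0ℤ          ∎))
    where open ℤ.≤-Reasoning
  ... | path p@(w , uniq) allowed = p Vector.∷ P , bound
    where
    rest : Σ (Fin j → Path G s t) λ P → ∀ e → usage G P e ℕ.≤ ℤ.∣ push f w -1ℤ e ∣
    rest = decompose j (push f w -1ℤ) (push-IsFlow flow w -1ℤ)
    P : Fin j → Path G s t
    P = proj₁ rest
    bound : ∀ e → usage G (p Vector.∷ P) e ℕ.≤ ℤ.∣ f e ∣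
    -- Abstracting over e ∈ₗ? edgesOf G w unfolds the usage of p ∷ P into that of P, plus one if e is on p.
    bound e with e ∈ₗ? edgesOf G w
    ... | yes e∈w =
      let unit , positive = pathFlow-∈ (forward f) w uniq allowed e∈w in
      subst (suc (usage G P e) ℕ.≤_) (pull-unit-∣∣ unit (toWitness {a? = 0ℤ ℤ.<? pathFlow w e * f e} positive))
            (ℕ.s≤s (proj₂ rest e))
    ... | no e∉w =
      subst (usage G P e ℕ.≤_)
            (cong ℤ.∣_∣ (trans (cong (λ o → f e + -1ℤ * o) (pathFlow-∉ w e∉w)) (ℤ.+-identityʳ (f e))))
            (proj₂ rest e)

  -- Shared edges and small cuts

  joins-crosses : ∀ {S e x y} → Joins G e x y → x ∈ S → y ∉ S → crosses S e ≡ true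
  joins-crosses {S} (inj₁ e≡xy) x∈S y∉S =
    trans (cong (λ p → lookup S (proj₁ p) xor lookup S (proj₂ p)) e≡xy) (cong₂ _xor_ ([]=⇒lookup x∈S) (lookup-∉ y∉S))
  joins-crosses {S} (inj₂ e≡yx) x∈S y∉S =
    trans (cong (λ p → lookup S (proj₁ p) xor lookup S (proj₂ p)) e≡yx) (cong₂ _xor_ (lookup-∉ y∉S) ([]=⇒lookup x∈S))

  leaving-edge : ∀ {S x z} (w : Walk G x z) → x ∈ S → z ∉ S → ∃ λ e → e ∈ₗ edgesOf G w × crosses S e ≡ true
  leaving-edge nil x∈S x∉S = contradiction x∈S x∉S
  leaving-edge {S} (cons {y = y} e j w) x∈S z∉S with y ∈? S
  ... | yes y∈S = let e' , e'∈w , crossing = leaving-edge w y∈S z∉S in e' , there e'∈w , crossing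
  ... | no  y∉S = e , here refl , joins-crosses j x∈S y∉S

  cut-load : ∀ {s t κ S} (P : Fin κ → Path G s t) → s ∈ S → t ∉ S →
             + κ ℤ.≤ ∑[ e < m ] (𝟙 (crosses S e) * + usage G P e)
  cut-load {κ = κ} {S} P s∈S t∉S = begin
    + κ
      ≡⟨ ∑-1 κ ⟨
    ∑[ i < κ ] 1ℤ
      ≤⟨ ∑-mono-≤ crossed ⟩
    ∑[ i < κ ] ∑[ e < m ] (𝟙 (crosses S e) * 𝟙 (on i e))
      ≡⟨ ∑-comm (λ i e → 𝟙 (crosses S e) * 𝟙 (on i e)) ⟩
    ∑[ e < m ] ∑[ i < κ ] (𝟙 (crosses S e) * 𝟙 (on i e))
      ≡⟨ sum-cong-≗ (λ e → *-distribˡ-sum (𝟙 (crosses S e)) (λ i → 𝟙 (on i e))) ⟨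
    ∑[ e < m ] (𝟙 (crosses S e) * ∑[ i < κ ] 𝟙 (on i e))
      ≡⟨ sum-cong-≗ (λ e → cong (𝟙 (crosses S e) *_) (∣tabulate∣≡∑𝟙 (λ i → on i e))) ⟨
    ∑[ e < m ] (𝟙 (crosses S e) * + usage G P e) ∎
    where
    open ℤ.≤-Reasoning
    on : Fin κ → E G → Bool
    on i e = does (e ∈ₗ? edgesOf G (proj₁ (P i)))
    crossed : ∀ i → 1ℤ ℤ.≤ ∑[ e < m ] (𝟙 (crosses S e) * 𝟙 (on i e))
    crossed i =
      let e , e∈Pi , crossing = leaving-edge {S = S} (proj₁ (P i)) s∈S t∉S in begin
      1ℤ
        ≡⟨ cong₂ (λ a b → 𝟙 a * 𝟙 b) crossing (dec-true (e ∈ₗ? edgesOf G (proj₁ (P i))) e∈Pi) ⟨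
      𝟙 (crosses S e) * 𝟙 (on i e)
        ≤⟨ ≤-∑ (λ e → 𝟙 (crosses S e) * 𝟙 (on i e)) (λ e → 0≤𝟙*𝟙 (crosses S e) (on i e)) e ⟩
      ∑[ e < m ] (𝟙 (crosses S e) * 𝟙 (on i e)) ∎

  capacity-uniform : ∀ r S → capacity (λ _ → r) S ≡ + (∣ cutEdges G S ∣ ℕ.* r)
  capacity-uniform r S = begin
    ∑[ e < m ] (𝟙 (crosses S e) * + r) ≡⟨ *-distribʳ-sum (+ r) (λ e → 𝟙 (crosses S e)) ⟨
    ∑[ e < m ] 𝟙 (crosses S e) * + r   ≡⟨ cong (_* + r) (∣tabulate∣≡∑𝟙 (crosses S)) ⟨
    + ∣ cutEdges G S ∣ * + r           ≡⟨ ℤ.pos-* ∣ cutEdges G S ∣ r ⟨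
    + (∣ cutEdges G S ∣ ℕ.* r)         ∎
    where open ≡-Reasoning

  sharedEdges-hit-small-cuts : ∀ {s t r κ c} → r ℕ.* c < κ → (P : Fin κ → Path G s t) →
                               HitsSmallCuts G s t c (sharedEdges G r P)
  sharedEdges-hit-small-cuts {r = r} {κ} {c} rc<κ P S s∈S t∉S small
    with nonempty? (cutEdges G S ∩ sharedEdges G r P)
  ... | yes shared-cut-edge = shared-cut-edge
  ... | no none = contradiction (ℤ.+<+ rc<κ) (ℤ.≤⇒≯ (begin
    + κ
      ≤⟨ cut-load P s∈S t∉S ⟩
    ∑[ e < m ] (𝟙 (crosses S e) * + usage G P e)
      ≤⟨ ∑-mono-≤ (λ e → 𝟙*-monoʳ-≤ (crosses S e) (+≤+ ∘ unshared e)) ⟩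
    capacity (λ _ → r) S
      ≡⟨ capacity-uniform r S ⟩
    + (∣ cutEdges G S ∣ ℕ.* r)
      ≤⟨ +≤+ (ℕ.*-monoˡ-≤ r small) ⟩
    + (c ℕ.* r)
      ≡⟨ cong +_ (ℕ.*-comm c r) ⟩
    + (r ℕ.* c) ∎))
    where
    open ℤ.≤-Reasoning
    unshared : ∀ e → crosses S e ≡ true → usage G P e ℕ.≤ r
    unshared e crossing = ℕ.≮⇒≥ λ r<usage →
      none (e , x∈p∩q⁺ (∈-tabulate⁺ crossing , ∈-tabulate⁺ (dec-true (r ℕ.<? usage G P e) r<usage)))

  shared⇒overused : ∀ {s t κ r} (P : Fin κ → Path G s t) {e} → e ∈ sharedEdges G r P → r < usage G P e
  shared⇒overused {r = r} P {e} e∈shared with r ℕ.<? usage G P e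
  ... | yes r<usage = r<usage
  ... | no  r≮usage =
    contradiction (trans (sym (∈-tabulate⁻ e∈shared)) (dec-false (r ℕ.<? usage G P e) r≮usage)) λ ()

  boost : Subset m → ℕ → ℕ → E G → ℕ
  boost Ẽ κ r e = if lookup Ẽ e then κ else r

  boosted-min-cut : ∀ {s t r κ c Ẽ} → r ℕ.≤ κ → κ ℕ.≤ r ℕ.* suc c → HitsSmallCuts G s t c Ẽ →
                    ∀ S → s ∈ S → t ∉ S → + κ ℤ.≤ capacity (boost Ẽ κ r) S
  boosted-min-cut {r = r} {κ} {c} {Ẽ} r≤κ κ≤r[1+c] hits S s∈S t∉S with ∣ cutEdges G S ∣ ℕ.≤? c
  ... | yes small =
    let e , e∈cut∩Ẽ = hits S s∈S t∉S small
        e∈cut , e∈Ẽ = x∈p∩q⁻ (cutEdges G S) Ẽ e∈cut∩Ẽ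
    in begin
      + κ
        ≡⟨ ℤ.*-identityˡ (+ κ) ⟨
      1ℤ * + κ
        ≡⟨ cong₂ (λ a b → 𝟙 a * + (if b then κ else r)) (∈-tabulate⁻ e∈cut) ([]=⇒lookup e∈Ẽ) ⟨
      𝟙 (crosses S e) * + boost Ẽ κ r e
        ≤⟨ ≤-∑ (λ e → 𝟙 (crosses S e) * + boost Ẽ κ r e) (λ e → 0≤𝟙*+ (crosses S e) (boost Ẽ κ r e)) e ⟩
      capacity (boost Ẽ κ r) S ∎
    where open ℤ.≤-Reasoning
  ... | no large = begin
    + κ                        ≤⟨ +≤+ κ≤r[1+c] ⟩
    + (r ℕ.* suc c)            ≤⟨ +≤+ (ℕ.*-monoʳ-≤ r (ℕ.≰⇒> large)) ⟩
    + (r ℕ.* ∣ cutEdges G S ∣) ≡⟨ cong +_ (ℕ.*-comm r _) ⟩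
    + (∣ cutEdges G S ∣ ℕ.* r) ≡⟨ capacity-uniform r S ⟨
    capacity (λ _ → r) S       ≤⟨ ∑-mono-≤ (λ e → 𝟙*-monoʳ-≤ (crosses S e) (λ _ → +≤+ (r≤boost e))) ⟩
    capacity (boost Ẽ κ r) S   ∎
    where
    open ℤ.≤-Reasoning
    r≤boost : ∀ e → r ℕ.≤ boost Ẽ κ r e
    r≤boost e with lookup Ẽ e
    ... | true  = r≤κ
    ... | false = ℕ.≤-refl

  avoiding-paths : ∀ {s t r κ c Ẽ} → r ℕ.≤ κ → κ ℕ.≤ r ℕ.* suc c → HitsSmallCuts G s t c Ẽ →
                   Σ (Fin κ → Path G s t) λ P → sharedEdges G r P ⊆ Ẽ
  avoiding-paths {s} {t} {r} {κ} {c} {Ẽ} r≤κ κ≤r[1+c] hits = P , shared⊆Ẽ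
    where
    flow : Σ Flow λ f → Feasible (boost Ẽ κ r) f × IsFlow s t (+ κ) f
    flow = integral-flow (boosted-min-cut r≤κ κ≤r[1+c] hits) κ ℕ.≤-refl
    f : Flow
    f = proj₁ flow
    feasible : Feasible (boost Ẽ κ r) f
    feasible = proj₁ (proj₂ flow)
    decomposition : Σ (Fin κ → Path G s t) λ P → ∀ e → usage G P e ℕ.≤ ℤ.∣ f e ∣
    decomposition = decompose κ f (proj₂ (proj₂ flow))
    P : Fin κ → Path G s t
    P = proj₁ decomposition

    shared⊆Ẽ : sharedEdges G r P ⊆ Ẽ
    shared⊆Ẽ {e} e∈shared with lookup Ẽ e in e∈?Ẽ
    ... | true  = lookup⇒[]= e Ẽ e∈?Ẽ
    ... | false = contradiction (shared⇒overused P e∈shared) (ℕ.≤⇒≯ (begin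
      usage G P e     ≤⟨ proj₂ decomposition e ⟩
      ℤ.∣ f e ∣       ≤⟨ -n≤i≤n⇒∣i∣≤n (proj₁ (feasible e)) (proj₂ (feasible e)) ⟩
      boost Ẽ κ r e   ≡⟨ cong (λ b → if b then κ else r) e∈?Ẽ ⟩
      r               ∎))
      where open ℕ.≤-Reasoning

lemma3 : (G : Graph) (s t : V G) (r κ : ℕ) (0<r : 0 < r) → r < κ →
         ∀ (k : ℕ) → IsOptUUMV G s t r κ k ⇔ IsOptEHSSC G s t (ceilDiv κ r 0<r ∸ 1) k
lemma3 G s t r κ 0<r r<κ k = mk⇔ to from
  where
  c : ℕ
  c = ceilDiv κ r 0<r ∸ 1

  bounds : r ℕ.* c < κ × κ ℕ.≤ r ℕ.* suc c
  bounds = ceilDiv-pred-bounds κ r 0<r (ℕ.<-trans 0<r r<κ)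

  hits : (P : Fin κ → Path G s t) → HitsSmallCuts G s t c (sharedEdges G r P)
  hits = sharedEdges-hit-small-cuts G (proj₁ bounds)

  avoid : ∀ {Ẽ} → HitsSmallCuts G s t c Ẽ → Σ (Fin κ → Path G s t) λ P → sharedEdges G r P ⊆ Ẽ
  avoid = avoiding-paths G (ℕ.<⇒≤ r<κ) (proj₂ bounds)

  to : IsOptUUMV G s t r κ k → IsOptEHSSC G s t c k
  to ((P , ∣shared∣≡k) , optimal) =
    (sharedEdges G r P , hits P , ∣shared∣≡k) ,
    λ Ẽ hitsẼ → let P' , shared⊆Ẽ = avoid hitsẼ in ℕ.≤-trans (optimal P') (p⊆q⇒∣p∣≤∣q∣ shared⊆Ẽ)

  from : IsOptEHSSC G s t c k → IsOptUUMV G s t r κ k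
  from ((Ẽ , hitsẼ , ∣Ẽ∣≡k) , optimal) =
    let P , shared⊆Ẽ = avoid hitsẼ
        ∣shared∣≤k = ℕ.≤-trans (p⊆q⇒∣p∣≤∣q∣ shared⊆Ẽ) (ℕ.≤-reflexive ∣Ẽ∣≡k)
    in (P , ℕ.≤-antisym ∣shared∣≤k (optimal _ (hits P))) , λ P' → optimal _ (hits P')
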